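{- Let $G$ be a unicyclic graph and let $v$ be a cycle vertex of maximal degree among all cycle vertices of $G$. Let $G'$ be the unicyclic graph obtained from $G$ by transforming the pendant tree $T_v$ into a star with center $v$ (that is, all edges of $T_v$ are deleted and $v$ is joined to every other vertex of $T_v$, the rest of $G$ being unchanged). Then $GA(G')\le GA(G)$.
   Context: All graphs are finite and simple; $d_G(w)$ is the degree of $w$. A unicyclic graph is a connected graph with exactly one cycle. $GA(G)=\sum_{xy\in E(G)} \frac{2\sqrt{d_G(x)d_G(y)}}{d_G(x)+d_G(y)}$. A cycle vertex is a vertex on the cycle. For a cycle vertex $v$, the pendant tree $T_v$ rooted at $v$ is the maximal connected subgraph of $G$ containing $v$ and no other cycle vertex. -}

module Defs where

open import Data.Bool using (Bool; true; false; if_then_else_; _∧_)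
open import Data.Nat using (ℕ; zero; suc; _+_; _*_; _^_; _≤_; _≤?_; _<ᵇ_)
open import Data.Nat.Properties using (m*n≢0; m^n≢0)
open import Data.Fin using (Fin; toℕ)
open import Data.Nat.ListAction using (sum)
open import Data.List using (List; []; _∷_; _++_; map; length; filter; allFin; concatMap; upTo)
open import Data.List.Membership.Propositional using (_∈_)
open import Data.List.Relation.Unary.Unique.Propositional using (Unique)
open import Data.Product using (Σ; _×_; _,_)
open import Data.Sum using (_⊎_)
open import Data.Unit using (⊤)
open import Data.Empty using (⊥)
open import Data.Integer using (+_)
open import Data.Rational.Unnormalised using (ℚᵘ; _/_; 0ℚᵘ) renaming (_+_ to _+q_; _≤_ to _≤q_)
open import Relation.Nullary using (¬_)
open import Relation.Binary.PropositionalEquality using (_≡_; _≢_)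
open import Function.Bundles using (_⇔_)

record Graph (n : ℕ) : Set where
  field
    adj     : Fin n → Fin n → Bool
    adj-sym : ∀ x y → adj x y ≡ adj y x
    adj-irr : ∀ x → adj x x ≡ false
open Graph public

module _ {n : ℕ} (G : Graph n) where

  Adj : Fin n → Fin n → Set
  Adj x y = adj G x y ≡ true

  deg : Fin n → ℕ
  deg x = sum (map (λ y → if adj G x y then 1 else 0) (allFin n))

  data WalkWithin (P : Fin n → Set) : Fin n → Fin n → Set where
    stop : ∀ {x} → WalkWithin P x x
    step : ∀ {x y z} → Adj x y → P y → WalkWithin P y z → WalkWithin P x z

  Connected : Set
  Connected = ∀ x y → WalkWithin (λ _ → ⊤) x y

  IsWalkList : List (Fin n) → Set
  IsWalkList []          = ⊤
  IsWalkList (x ∷ [])    = ⊤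
  IsWalkList (x ∷ y ∷ r) = Adj x y × IsWalkList (y ∷ r)

  close : List (Fin n) → List (Fin n)
  close []      = []
  close (x ∷ r) = x ∷ r ++ x ∷ []

  IsCycle : List (Fin n) → Set
  IsCycle c = 3 ≤ length c × Unique c × IsWalkList (close c)

  consecutive : List (Fin n) → List (Fin n × Fin n)
  consecutive []          = []
  consecutive (x ∷ [])    = []
  consecutive (x ∷ y ∷ r) = (x , y) ∷ consecutive (y ∷ r)

  CycleEdge : List (Fin n) → Fin n → Fin n → Set
  CycleEdge c a b = ((a , b) ∈ consecutive (close c)) ⊎ ((b , a) ∈ consecutive (close c))

  -- connected with exactly one cycle (cycles identified by their edge sets)
  Unicyclic : Set
  Unicyclic = Connected × Σ (List (Fin n)) λ c → IsCycle c ×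
                (∀ d → IsCycle d → ∀ a b → CycleEdge c a b ⇔ CycleEdge d a b)

  CycleVertex : Fin n → Set
  CycleVertex u = Σ (List (Fin n)) λ c → IsCycle c × u ∈ c

  -- w is a vertex of the pendant tree T_v: reachable from v without passing
  -- through any cycle vertex other than v
  InPendantTree : Fin n → Fin n → Set
  InPendantTree v w = WalkWithin (λ u → ¬ CycleVertex u) v w

IsStarTransform : ∀ {n} → Graph n → Fin n → Graph n → Set
IsStarTransform {n} G v G' = ∀ (x y : Fin n) →
  ((InPendantTree G v x × InPendantTree G v y) →
     (Adj G' x y ⇔ (x ≢ y × (x ≡ v ⊎ y ≡ v)))) ×
  (¬ (InPendantTree G v x × InPendantTree G v y) → adj G' x y ≡ adj G x y)

-- Sums of square roots, compared exactly via rational approximations.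
-- A "surd sum" is a list of pairs (m , q) denoting Σ √m / q.

-- ⌊√m⌋ = #{ r ∈ [1, m] | r * r ≤ m }
isqrt : ℕ → ℕ
isqrt m = length (filter (λ r → r * r ≤? m) (map suc (upTo m)))

-- lower approximation ⌊√(m·4^k)⌋ / (q·2^k) of √m/q, error < 1/2^k when q ≥ 1
lowTerm : ℕ → ℕ × ℕ → ℚᵘ
lowTerm k (m , zero)  = 0ℚᵘ
lowTerm k (m , suc q) = (+ isqrt (m * 4 ^ k)) / (suc q * 2 ^ k)
  where instance _ = m*n≢0 (suc q) (2 ^ k) {{_}} {{m^n≢0 2 k}}

low : ℕ → List (ℕ × ℕ) → ℚᵘ
low k []      = 0ℚᵘ
low k (t ∷ s) = lowTerm k t +q low k s

errBound : ℕ → ℕ → ℚᵘ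
errBound k ℓ = (+ ℓ) / (2 ^ k)
  where instance _ = m^n≢0 2 k

-- real inequality Σ_A ≤ Σ_B (all denominators positive):
-- for every k, L_k(A) ≤ L_k(B) + |B| / 2^k
_≤√_ : List (ℕ × ℕ) → List (ℕ × ℕ) → Set
A ≤√ B = ∀ k → low k A ≤q (low k B +q errBound k (length B))

infix 4 _≤√_

-- Geometric-arithmetic index:  GA(G) = Σ_{xy ∈ E} 2√(d_x d_y)/(d_x + d_y)
-- each edge {x,y} (x < y) contributes √(4 d_x d_y) / (d_x + d_y)

GAterms : ∀ {n} → Graph n → List (ℕ × ℕ)
GAterms {n} G = concatMap (λ x → concatMap (λ y →
  if adj G x y ∧ (toℕ x <ᵇ toℕ y)
  then (4 * deg G x * deg G y , deg G x + deg G y) ∷ []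
  else []) (allFin n)) (allFin n)

_GA≤_ : ∀ {n m} → Graph n → Graph m → Set
G GA≤ H = GAterms G ≤√ GAterms H

-- Give every vertex w ≠ v of Tᵥ the edge to its parent (its neighbour on a shortest walk from v).
-- This matches each star edge vw of G′ injectively with an edge of Tᵥ whose end degrees are at
-- most D = d_G′(v), and the weight of a pendant edge of a degree-D centre, 2√D/(D+1), is at most
-- that of any such edge. Edges of G′ outside Tᵥ are edges of G; their weights are unchanged except
-- on the cycle edges at v, where one end degree grows from d_G(v) to D while the other, a cycle
-- vertex, has degree at most d_G(v), and 2√(xc)/(x+c) decreases in x ≥ c. That only v joins Tᵥ
-- to the other cycle vertices is where the uniqueness of the cycle is used.
-- Membership in Tᵥ and the depths are obtained classically, which is harmless because each
-- approximate inequality that constitutes _GA≤_ is decidable.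

module Submission where

open import Defs
open import Level using (0ℓ)
open import Function using (_∘_; id; _⇔_; Equivalence; mk⇔)
open import Data.Bool using (Bool; true; false; if_then_else_; _∧_; not; T)
open import Data.Bool.Properties using (∧-identityʳ; T-∧; T-≡)
open import Data.Nat using (ℕ; zero; suc; _+_; _*_; _^_; NonZero; >-nonZero; _<ᵇ_; _≤_; _<_; _≤?_; _≰_; z≤n; s≤s)
open import Data.Nat.Properties hiding (_≟_)
open import Data.Nat.Induction using (<-rec)
open import Data.Nat.ListAction using (sum)
open import Data.Nat.Tactic.RingSolver using (solve-∀)
open import Data.Integer using (+_)
import Data.Integer as ℤ
import Data.Integer.Properties as ℤ
open import Data.Rational.Unnormalised using (_/_; 0ℚᵘ)
import Data.Rational.Unnormalised as ℚ
import Data.Rational.Unnormalised.Properties as ℚ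
open import Data.Fin using (Fin; toℕ; _≟_)
import Data.Fin as Fin
open import Data.Fin.Properties using (toℕ-injective; ∀-cons)
open import Data.Product using (_×_; _,_; proj₁; proj₂; ∃; Σ)
import Data.Product
open import Data.Sum using (_⊎_; inj₁; inj₂; [_,_]′)
import Data.Sum
open import Data.Unit using (⊤; tt)
open import Data.List using (List; []; _∷_; [_]; _++_; length; map; filter; filterᵇ; upTo; concatMap; cartesianProduct; allFin; tabulate)
open import Data.List.Properties
  using (length-++; length-++-≤ʳ; length-filter; length-map; length-upTo; ++-assoc; map-++; map-∘; map-tabulate;
         filter-++; filter-accept; filter-reject; upTo-∷ʳ; concatMap-++; concatMap-map)
open import Data.List.Membership.Propositional using (_∈_)
open import Data.List.Membership.Propositional.Properties
  using (∈-∃++; ∈-++⁻; ∈-++⁺ˡ; ∈-++⁺ʳ; ∈-map⁻; ∈-filter⁺; ∈-filter⁻; ∈-cartesianProduct⁺; ∈-allFin)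
open import Data.List.Relation.Unary.Any using (here; there)
open import Data.List.Relation.Unary.All using (All; []; _∷_)
import Data.List.Relation.Unary.All as All
import Data.List.Relation.Unary.All.Properties as All
open import Data.List.Relation.Unary.AllPairs using ([]; _∷_)
open import Data.List.Relation.Unary.Unique.Propositional using (Unique)
import Data.List.Relation.Unary.Unique.Propositional.Properties as Unique
open import Data.List.Relation.Binary.Subset.Propositional using (_⊆_)
open import Data.List.Relation.Binary.Permutation.Propositional as Perm using (_↭_; ↭-trans; ↭-prep)
open import Data.List.Relation.Binary.Permutation.Propositional.Properties using (shift; ↭-length) renaming (map⁺ to ↭-map⁺)
open import Relation.Nullary using (¬_; Dec; yes; no; does; contradiction)
open import Relation.Nullary.Decidable using (T?; ¬¬-excluded-middle; decidable-stable)
open import Relation.Nullary.Negation using (¬¬-Monad)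
open import Effect.Monad using (RawMonad)
open import Relation.Binary.PropositionalEquality hiding ([_])

open RawMonad (¬¬-Monad {a = 0ℓ}) using (pure; _>>=_)

squaresUpTo : ℕ → ℕ → ℕ
squaresUpTo m N = length (filter (λ r → r * r ≤? m) (map suc (upTo N)))

squaresUpTo-suc : ∀ m N → squaresUpTo m (suc N) ≡ squaresUpTo m N + length (filter (λ r → r * r ≤? m) [ suc N ])
squaresUpTo-suc m N = begin
  length (filter P? (map suc (upTo (suc N))))                  ≡⟨ cong (λ l → length (filter P? (map suc l))) (sym (upTo-∷ʳ N)) ⟩
  length (filter P? (map suc (upTo N ++ [ N ])))                ≡⟨ cong (λ l → length (filter P? l)) (map-++ suc (upTo N) [ N ]) ⟩
  length (filter P? (map suc (upTo N) ++ [ suc N ]))            ≡⟨ cong length (filter-++ P? (map suc (upTo N)) [ suc N ]) ⟩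
  length (filter P? (map suc (upTo N)) ++ filter P? [ suc N ])  ≡⟨ length-++ (filter P? (map suc (upTo N))) ⟩
  squaresUpTo m N + length (filter P? [ suc N ])                ∎
  where
  open ≡-Reasoning
  P? = λ r → r * r ≤? m

squaresUpTo-≤ : ∀ m N → squaresUpTo m N ≤ N
squaresUpTo-≤ m N = begin
  squaresUpTo m N            ≤⟨ length-filter (λ r → r * r ≤? m) (map suc (upTo N)) ⟩
  length (map suc (upTo N))  ≡⟨ length-map suc (upTo N) ⟩
  length (upTo N)            ≡⟨ length-upTo N ⟩
  N                          ∎
  where open ≤-Reasoning

squaresUpTo-accept : ∀ m N → suc N * suc N ≤ m → squaresUpTo m (suc N) ≡ suc (squaresUpTo m N)
squaresUpTo-accept m N p = begin
  squaresUpTo m (suc N)                                             ≡⟨ squaresUpTo-suc m N ⟩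
  squaresUpTo m N + length (filter (λ r → r * r ≤? m) [ suc N ])
    ≡⟨ cong (λ l → squaresUpTo m N + length l) (filter-accept (λ r → r * r ≤? m) p) ⟩
  squaresUpTo m N + 1                                               ≡⟨ +-comm (squaresUpTo m N) 1 ⟩
  suc (squaresUpTo m N)                                             ∎
  where open ≡-Reasoning

squaresUpTo-reject : ∀ m N → suc N * suc N ≰ m → squaresUpTo m (suc N) ≡ squaresUpTo m N
squaresUpTo-reject m N p = begin
  squaresUpTo m (suc N)                                             ≡⟨ squaresUpTo-suc m N ⟩
  squaresUpTo m N + length (filter (λ r → r * r ≤? m) [ suc N ])
    ≡⟨ cong (λ l → squaresUpTo m N + length l) (filter-reject (λ r → r * r ≤? m) p) ⟩
  squaresUpTo m N + 0                                               ≡⟨ +-identityʳ (squaresUpTo m N) ⟩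
  squaresUpTo m N                                                   ∎
  where open ≡-Reasoning

-- Counting the r ∈ [1, N] with r² ≤ m finds ⌊√m⌋, unless the range stops short of it.
squaresUpTo-spec : ∀ m N → let s = squaresUpTo m N in
  s * s ≤ m × (s ≡ N ⊎ m < suc s * suc s)
squaresUpTo-spec m zero = z≤n , inj₁ refl
squaresUpTo-spec m (suc N) with suc N * suc N ≤? m | squaresUpTo-spec m N
... | yes N+1²≤m | _ , inj₁ s≡N rewrite squaresUpTo-accept m N N+1²≤m | s≡N = N+1²≤m , inj₁ refl
... | yes N+1²≤m | _ , inj₂ m<[s+1]² =
  contradiction (≤-trans (*-mono-≤ s+1≤N+1 s+1≤N+1) N+1²≤m) (<⇒≱ m<[s+1]²)
  where s+1≤N+1 = s≤s (squaresUpTo-≤ m N)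
... | no N+1²≰m | s²≤m , inj₁ s≡N rewrite squaresUpTo-reject m N N+1²≰m =
  s²≤m , inj₂ (subst (λ s → m < suc s * suc s) (sym s≡N) (≰⇒> N+1²≰m))
... | no N+1²≰m | s²≤m , inj₂ m<[s+1]² rewrite squaresUpTo-reject m N N+1²≰m = s²≤m , inj₂ m<[s+1]²

isqrt-spec : ∀ m → isqrt m * isqrt m ≤ m × m < suc (isqrt m) * suc (isqrt m)
isqrt-spec m with squaresUpTo-spec m m
... | s²≤m , inj₂ m<[s+1]² = s²≤m , m<[s+1]²
... | s²≤m , inj₁ s≡m rewrite s≡m = s²≤m , s≤s (m≤m+n m (m * suc m))

fraction-≤ : ∀ a b d e .{{_ : NonZero d}} .{{_ : NonZero e}} → a * e ≤ b * d → + a / d ℚ.≤ + b / e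
fraction-≤ a b (suc d) (suc e) ae≤bd = ℚ.*≤* (subst₂ ℤ._≤_ (ℤ.pos-* a (suc e)) (ℤ.pos-* b (suc d)) (ℤ.+≤+ ae≤bd))

fraction-+ : ∀ a b d e .{{_ : NonZero d}} .{{_ : NonZero e}} .{{_ : NonZero (d * e)}} →
  + a / d ℚ.+ + b / e ≡ + (a * e + b * d) / (d * e)
fraction-+ a b (suc d) (suc e) = cong (λ z → ℚ.mkℚᵘ z (e + d * suc e))
  (trans (cong₂ ℤ._+_ (sym (ℤ.pos-* a (suc e))) (sym (ℤ.pos-* b (suc d)))) (sym (ℤ.pos-+ (a * suc e) (b * suc d))))

squares-cancel-< : ∀ x y → x * x < y * y → x < y
squares-cancel-< x y x²<y² = ≰⇒> (λ y≤x → <⇒≱ x²<y² (*-mono-≤ y≤x y≤x))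

-- (m , q) ≤ₛ (m′ , q′) says √m / q ≤ √m′ / q′, with both sides squared and denominators cleared.
_≤ₛ_ : ℕ × ℕ → ℕ × ℕ → Set
(m , q) ≤ₛ (m′ , q′) = m * (q′ * q′) ≤ m′ * (q * q)

infix 4 _≤ₛ_

≤ₛ-refl : ∀ t → t ≤ₛ t
≤ₛ-refl _ = ≤-refl

isqrt-scaled-< : ∀ m m′ q q′ X → (m , suc q) ≤ₛ (m′ , q′) →
  isqrt (m * X) * q′ < suc (isqrt (m′ * X)) * suc q
isqrt-scaled-< m m′ q q′ X mq≤m′q′ = squares-cancel-< _ _ (begin-strict
  (a * q′) * (a * q′)          ≡⟨ square-* a q′ ⟩
  (a * a) * (q′ * q′)          ≤⟨ *-monoˡ-≤ (q′ * q′) (proj₁ (isqrt-spec (m * X))) ⟩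
  (m * X) * (q′ * q′)          ≡⟨ swap-middle m X (q′ * q′) ⟩
  (m * (q′ * q′)) * X          ≤⟨ *-monoˡ-≤ X mq≤m′q′ ⟩
  (m′ * (Q * Q)) * X           ≡⟨ swap-middle m′ (Q * Q) X ⟩
  (m′ * X) * (Q * Q)           <⟨ *-monoˡ-< (Q * Q) (proj₂ (isqrt-spec (m′ * X))) ⟩
  (suc b * suc b) * (Q * Q)    ≡⟨ square-* (suc b) Q ⟨
  (suc b * Q) * (suc b * Q)    ∎)
  where
  open ≤-Reasoning
  Q = suc q
  a = isqrt (m * X)
  b = isqrt (m′ * X)
  square-* : ∀ x y → (x * y) * (x * y) ≡ (x * x) * (y * y)
  square-* = solve-∀
  swap-middle : ∀ x y z → (x * y) * z ≡ (x * z) * y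
  swap-middle = solve-∀

errBound-suc : ∀ k ℓ → errBound k 1 ℚ.+ errBound k ℓ ℚ.≤ errBound k (suc ℓ)
errBound-suc k ℓ = begin
  + 1 / P ℚ.+ + ℓ / P         ≡⟨ fraction-+ 1 ℓ P P ⟩
  + (1 * P + ℓ * P) / (P * P)  ≤⟨ fraction-≤ (1 * P + ℓ * P) (suc ℓ) (P * P) P (≤-reflexive (rearrange ℓ P)) ⟩
  + suc ℓ / P                  ∎
  where
  open ℚ.≤-Reasoning
  P = 2 ^ k
  instance
    _ = m^n≢0 2 k
    _ = m*n≢0 P P
  rearrange : ∀ ℓ P → (1 * P + ℓ * P) * P ≡ suc ℓ * (P * P)
  rearrange = solve-∀

lowTerm-nonneg : ∀ k t → 0ℚᵘ ℚ.≤ lowTerm k t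
lowTerm-nonneg k (m , zero)  = ℚ.≤-refl
lowTerm-nonneg k (m , suc q) = fraction-≤ 0 (isqrt (m * 4 ^ k)) 1 (suc q * 2 ^ k) z≤n
  where instance _ = m*n≢0 (suc q) (2 ^ k) {{_}} {{m^n≢0 2 k}}

errBound-nonneg : ∀ k ℓ → 0ℚᵘ ℚ.≤ errBound k ℓ
errBound-nonneg k ℓ = fraction-≤ 0 ℓ 1 (2 ^ k) {{_}} {{m^n≢0 2 k}} z≤n

-- Each lower approximation errs by less than 1/2ᵏ, so comparable terms stay comparable up to 1/2ᵏ.
lowTerm-≤ₛ : ∀ k t t′ → t ≤ₛ t′ → 1 ≤ proj₂ t′ → lowTerm k t ℚ.≤ lowTerm k t′ ℚ.+ errBound k 1
lowTerm-≤ₛ k (m , zero) t′ _ _ = ℚ.+-mono-≤ (lowTerm-nonneg k t′) (errBound-nonneg k 1)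
lowTerm-≤ₛ k (m , suc q) (m′ , suc q″) t≤t′ _ = begin
  + a / (Q * P)                                 ≤⟨ fraction-≤ a (b * P + 1 * (Q′ * P)) (Q * P) (Q′ * P * P) key ⟩
  + (b * P + 1 * (Q′ * P)) / (Q′ * P * P)       ≡⟨ fraction-+ b 1 (Q′ * P) P ⟨
  + b / (Q′ * P) ℚ.+ + 1 / P                    ∎
  where
  open ℚ.≤-Reasoning
  P = 2 ^ k
  Q = suc q
  Q′ = suc q″
  a = isqrt (m * 4 ^ k)
  b = isqrt (m′ * 4 ^ k)
  instance
    _ = m^n≢0 2 k
    _ = m*n≢0 Q P
    _ = m*n≢0 Q′ P
    _ = m*n≢0 (Q′ * P) P
  aQ′≤bQ+Q′Q : a * Q′ ≤ b * Q + Q′ * Q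
  aQ′≤bQ+Q′Q = ≤-trans (<⇒≤ (isqrt-scaled-< m m′ q Q′ (4 ^ k) t≤t′))
                       (≤-trans (≤-reflexive (+-comm Q (b * Q))) (+-monoʳ-≤ (b * Q) (m≤n*m Q Q′)))
  key : a * (Q′ * P * P) ≤ (b * P + 1 * (Q′ * P)) * (Q * P)
  key = subst₂ _≤_ (sym (lhs a Q′ P)) (sym (rhs b Q Q′ P)) (*-monoˡ-≤ (P * P) aQ′≤bQ+Q′Q)
    where
    lhs : ∀ a Q′ P → a * (Q′ * P * P) ≡ (a * Q′) * (P * P)
    lhs = solve-∀
    rhs : ∀ b Q Q′ P → (b * P + 1 * (Q′ * P)) * (Q * P) ≡ (b * Q + Q′ * Q) * (P * P)
    rhs = solve-∀

low-++ : ∀ k xs ys → low k (xs ++ ys) ≡ low k xs ℚ.+ low k ys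
low-++ k []       ys = sym (ℚ.+-identityˡ-≡ (low k ys))
low-++ k (t ∷ xs) ys = begin
  lowTerm k t ℚ.+ low k (xs ++ ys)               ≡⟨ cong (lowTerm k t ℚ.+_) (low-++ k xs ys) ⟩
  lowTerm k t ℚ.+ (low k xs ℚ.+ low k ys)        ≡⟨ ℚ.+-assoc-≡ (lowTerm k t) (low k xs) (low k ys) ⟨
  (lowTerm k t ℚ.+ low k xs) ℚ.+ low k ys        ∎
  where open ≡-Reasoning

low-↭ : ∀ k {xs ys} → xs ↭ ys → low k xs ≡ low k ys
low-↭ k Perm.refl           = refl
low-↭ k (Perm.prep t p)     = cong (lowTerm k t ℚ.+_) (low-↭ k p)
low-↭ k (Perm.swap {xs} {ys} t u p) = begin
  lowTerm k t ℚ.+ (lowTerm k u ℚ.+ low k xs)     ≡⟨ ℚ.+-assoc-≡ (lowTerm k t) (lowTerm k u) (low k xs) ⟨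
  (lowTerm k t ℚ.+ lowTerm k u) ℚ.+ low k xs     ≡⟨ cong₂ ℚ._+_ (ℚ.+-comm-≡ (lowTerm k t) (lowTerm k u)) (low-↭ k p) ⟩
  (lowTerm k u ℚ.+ lowTerm k t) ℚ.+ low k ys     ≡⟨ ℚ.+-assoc-≡ (lowTerm k u) (lowTerm k t) (low k ys) ⟩
  lowTerm k u ℚ.+ (lowTerm k t ℚ.+ low k ys)     ∎
  where open ≡-Reasoning
low-↭ k (Perm.trans p q)    = trans (low-↭ k p) (low-↭ k q)

low-nonneg : ∀ k xs → 0ℚᵘ ℚ.≤ low k xs
low-nonneg k []       = ℚ.≤-refl
low-nonneg k (t ∷ xs) = ℚ.+-mono-≤ (lowTerm-nonneg k t) (low-nonneg k xs)

Unique-++⁻ʳ : ∀ {A : Set} (xs : List A) {ys} → Unique (xs ++ ys) → Unique ys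
Unique-++⁻ʳ []       ys! = ys!
Unique-++⁻ʳ (x ∷ xs) (_ ∷ xs++ys!) = Unique-++⁻ʳ xs xs++ys!

unique-⊆⇒↭ : ∀ {A : Set} {xs ys : List A} → Unique xs → xs ⊆ ys → ∃ λ zs → ys ↭ xs ++ zs
unique-⊆⇒↭ {xs = []} {ys} _ _ = ys , Perm.refl
unique-⊆⇒↭ {xs = x ∷ xs} (x∉xs ∷ xs!) x∷xs⊆ys with ∈-∃++ (x∷xs⊆ys (here refl))
... | pre , post , refl with unique-⊆⇒↭ xs! xs⊆pre++post
  where
  xs⊆pre++post : xs ⊆ pre ++ post
  xs⊆pre++post z∈xs with ∈-++⁻ pre (x∷xs⊆ys (there z∈xs))
  ... | inj₁ z∈pre         = ∈-++⁺ˡ z∈pre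
  ... | inj₂ (here refl)   = contradiction refl (All.lookup x∉xs z∈xs)
  ... | inj₂ (there z∈post) = ∈-++⁺ʳ pre z∈post
... | zs , pre++post↭xs++zs = zs , ↭-trans (shift x pre post) (↭-prep x pre++post↭xs++zs)

ℚ-+-interchange : ∀ p q r s → (p ℚ.+ q) ℚ.+ (r ℚ.+ s) ≡ (p ℚ.+ r) ℚ.+ (q ℚ.+ s)
ℚ-+-interchange p q r s = begin
  (p ℚ.+ q) ℚ.+ (r ℚ.+ s)   ≡⟨ ℚ.+-assoc-≡ p q (r ℚ.+ s) ⟩
  p ℚ.+ (q ℚ.+ (r ℚ.+ s))   ≡⟨ cong (p ℚ.+_) (ℚ.+-assoc-≡ q r s) ⟨
  p ℚ.+ ((q ℚ.+ r) ℚ.+ s)   ≡⟨ cong (λ u → p ℚ.+ (u ℚ.+ s)) (ℚ.+-comm-≡ q r) ⟩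
  p ℚ.+ ((r ℚ.+ q) ℚ.+ s)   ≡⟨ cong (p ℚ.+_) (ℚ.+-assoc-≡ r q s) ⟩
  p ℚ.+ (r ℚ.+ (q ℚ.+ s))   ≡⟨ ℚ.+-assoc-≡ p r (q ℚ.+ s) ⟨
  (p ℚ.+ r) ℚ.+ (q ℚ.+ s)   ∎
  where open ≡-Reasoning

low-map-≤ₛ : ∀ {A : Set} k (f g : A → ℕ × ℕ) xs →
  (∀ {a} → a ∈ xs → f a ≤ₛ g a) → (∀ {a} → a ∈ xs → 1 ≤ proj₂ (g a)) →
  low k (map f xs) ℚ.≤ low k (map g xs) ℚ.+ errBound k (length xs)
low-map-≤ₛ k f g []       _   _   = ℚ.+-mono-≤ ℚ.≤-refl (errBound-nonneg k 0)
low-map-≤ₛ k f g (a ∷ xs) f≤g g>0 = begin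
  lowTerm k (f a) ℚ.+ low k (map f xs)
    ≤⟨ ℚ.+-mono-≤ (lowTerm-≤ₛ k (f a) (g a) (f≤g (here refl)) (g>0 (here refl)))
                  (low-map-≤ₛ k f g xs (f≤g ∘ there) (g>0 ∘ there)) ⟩
  (lowTerm k (g a) ℚ.+ errBound k 1) ℚ.+ (low k (map g xs) ℚ.+ errBound k (length xs))
    ≡⟨ ℚ-+-interchange (lowTerm k (g a)) (errBound k 1) (low k (map g xs)) (errBound k (length xs)) ⟩
  low k (map g (a ∷ xs)) ℚ.+ (errBound k 1 ℚ.+ errBound k (length xs))
    ≤⟨ ℚ.+-monoʳ-≤ (low k (map g (a ∷ xs))) (errBound-suc k (length xs)) ⟩
  low k (map g (a ∷ xs)) ℚ.+ errBound k (length (a ∷ xs))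
    ∎
  where open ℚ.≤-Reasoning

errBound-mono : ∀ k {ℓ ℓ′} → ℓ ≤ ℓ′ → errBound k ℓ ℚ.≤ errBound k ℓ′
errBound-mono k {ℓ} {ℓ′} ℓ≤ℓ′ = fraction-≤ ℓ ℓ′ (2 ^ k) (2 ^ k) (*-monoˡ-≤ (2 ^ k) ℓ≤ℓ′)
  where instance _ = m^n≢0 2 k

module _ {A : Set} {xs ys : List A} (xs! : Unique xs) (xs⊆ys : xs ⊆ ys) where

  length-unique-⊆ : length xs ≤ length ys
  length-unique-⊆ with zs , ys↭xs++zs ← unique-⊆⇒↭ xs! xs⊆ys = begin
    length xs               ≤⟨ m≤m+n (length xs) (length zs) ⟩
    length xs + length zs   ≡⟨ length-++ xs ⟨
    length (xs ++ zs)       ≡⟨ ↭-length ys↭xs++zs ⟨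
    length ys               ∎
    where open ≤-Reasoning

  low-map-unique-⊆ : ∀ k (g : A → ℕ × ℕ) → low k (map g xs) ℚ.≤ low k (map g ys)
  low-map-unique-⊆ k g with zs , ys↭xs++zs ← unique-⊆⇒↭ xs! xs⊆ys = begin
    low k (map g xs)                              ≡⟨ ℚ.+-identityʳ-≡ (low k (map g xs)) ⟨
    low k (map g xs) ℚ.+ 0ℚᵘ                      ≤⟨ ℚ.+-monoʳ-≤ (low k (map g xs)) (low-nonneg k (map g zs)) ⟩
    low k (map g xs) ℚ.+ low k (map g zs)         ≡⟨ low-++ k (map g xs) (map g zs) ⟨
    low k (map g xs ++ map g zs)                  ≡⟨ cong (low k) (map-++ g xs zs) ⟨
    low k (map g (xs ++ zs))                      ≡⟨ low-↭ k (↭-map⁺ g ys↭xs++zs) ⟨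
    low k (map g ys)                              ∎
    where open ℚ.≤-Reasoning

Unique-map⁺-local : ∀ {A B : Set} (φ : A → B) {xs} → Unique xs →
  (∀ {a b} → a ∈ xs → b ∈ xs → φ a ≡ φ b → a ≡ b) → Unique (map φ xs)
Unique-map⁺-local φ {[]}     []           _     = []
Unique-map⁺-local φ {x ∷ xs} (x∉xs ∷ xs!) φ-inj =
  All.tabulate φx≢ ∷ Unique-map⁺-local φ xs! (λ a∈ b∈ → φ-inj (there a∈) (there b∈))
  where
  φx≢ : ∀ {z} → z ∈ map φ xs → φ x ≢ z
  φx≢ z∈ φx≡z with b , b∈ , refl ← ∈-map⁻ φ z∈ = All.lookup x∉xs b∈ (φ-inj (here refl) (there b∈) φx≡z)

≤√-by-injection : ∀ {A B : Set} (f : A → ℕ × ℕ) (g : B → ℕ × ℕ) (xs : List A) (ys : List B) (φ : A → B) →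
  Unique xs → (∀ {a b} → a ∈ xs → b ∈ xs → φ a ≡ φ b → a ≡ b) → (∀ {a} → a ∈ xs → φ a ∈ ys) →
  (∀ {a} → a ∈ xs → f a ≤ₛ g (φ a)) → (∀ {b} → b ∈ ys → 1 ≤ proj₂ (g b)) →
  map f xs ≤√ map g ys
≤√-by-injection f g xs ys φ xs! φ-inj φ∈ys f≤gφ g>0 k = begin
  low k (map f xs)
    ≤⟨ low-map-≤ₛ k f (g ∘ φ) xs f≤gφ (g>0 ∘ φ∈ys) ⟩
  low k (map (g ∘ φ) xs) ℚ.+ errBound k (length xs)
    ≤⟨ ℚ.+-mono-≤ low-φxs≤low-ys (errBound-mono k |xs|≤|ys|) ⟩
  low k (map g ys) ℚ.+ errBound k (length (map g ys))
    ∎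
  where
  open ℚ.≤-Reasoning
  φxs! : Unique (map φ xs)
  φxs! = Unique-map⁺-local φ xs! φ-inj
  φxs⊆ys : map φ xs ⊆ ys
  φxs⊆ys φa∈ with _ , a∈ , refl ← ∈-map⁻ φ φa∈ = φ∈ys a∈
  low-φxs≤low-ys : low k (map (g ∘ φ) xs) ℚ.≤ low k (map g ys)
  low-φxs≤low-ys = subst (λ l → low k l ℚ.≤ low k (map g ys)) (sym (map-∘ {g = g} {f = φ} xs)) (low-map-unique-⊆ φxs! φxs⊆ys k g)
  |xs|≤|ys| : length xs ≤ length (map g ys)
  |xs|≤|ys| = subst₂ _≤_ (length-map φ xs) (sym (length-map g ys)) (length-unique-⊆ φxs! φxs⊆ys)

-- The edge weight 2√(ab)/(a+b)

gaTerm : ℕ → ℕ → ℕ × ℕ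
gaTerm a b = (4 * a * b , a + b)

gaTerm-comm : ∀ a b → gaTerm a b ≡ gaTerm b a
gaTerm-comm a b = cong₂ _,_ (4ab≡4ba a b) (+-comm a b)
  where
  4ab≡4ba : ∀ a b → 4 * a * b ≡ 4 * b * a
  4ab≡4ba = solve-∀

-- The two sides differ by 4(Da − b)(Db − a).
gaTerm-pendant-≤ₛ : ∀ D a b → 1 ≤ a → 1 ≤ b → a ≤ D → b ≤ D → gaTerm D 1 ≤ₛ gaTerm a b
gaTerm-pendant-≤ₛ D a b 1≤a 1≤b a≤D b≤D
  with u , b+u≡Da ← m≤n⇒∃[o]m+o≡n (≤-trans b≤D (m≤m*n D a {{>-nonZero 1≤a}}))
     | w , a+w≡Db ← m≤n⇒∃[o]m+o≡n (≤-trans a≤D (m≤m*n D b {{>-nonZero 1≤b}})) = begin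
  4 * D * 1 * ((a + b) * (a + b))                    ≡⟨ lhs-expand D a b ⟩
  4 * ((D * a) * a + 2 * (D * a * b) + (D * b) * b)   ≡⟨ cong₂ (λ X Y → 4 * (X * a + 2 * (D * a * b) + Y * b)) b+u≡Da a+w≡Db ⟨
  4 * ((b + u) * a + 2 * Z + (a + w) * b)             ≤⟨ m≤m+n _ (4 * (u * w)) ⟩
  4 * ((b + u) * a + 2 * Z + (a + w) * b) + 4 * (u * w) ≡⟨ difference a b u w Z ⟩
  4 * ((b + u) * (a + w) + 2 * Z + a * b)             ≡⟨ cong₂ (λ X Y → 4 * (X * Y + 2 * (D * a * b) + a * b)) b+u≡Da a+w≡Db ⟩
  4 * ((D * a) * (D * b) + 2 * (D * a * b) + a * b)   ≡⟨ rhs-expand D a b ⟨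
  4 * a * b * ((D + 1) * (D + 1))                      ∎
  where
  open ≤-Reasoning
  Z = D * a * b
  lhs-expand : ∀ D a b → 4 * D * 1 * ((a + b) * (a + b)) ≡ 4 * ((D * a) * a + 2 * (D * a * b) + (D * b) * b)
  lhs-expand = solve-∀
  rhs-expand : ∀ D a b → 4 * a * b * ((D + 1) * (D + 1)) ≡ 4 * ((D * a) * (D * b) + 2 * (D * a * b) + a * b)
  rhs-expand = solve-∀
  difference : ∀ a b u w Z → 4 * ((b + u) * a + 2 * Z + (a + w) * b) + 4 * (u * w) ≡ 4 * ((b + u) * (a + w) + 2 * Z + a * b)
  difference = solve-∀

gaTerm-antitone : ∀ c d D → c ≤ d → d ≤ D → gaTerm D c ≤ₛ gaTerm d c
gaTerm-antitone c d D c≤d d≤D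
  with f , refl ← m≤n⇒∃[o]m+o≡n c≤d
     | e , refl ← m≤n⇒∃[o]m+o≡n d≤D =
  subst (4 * (c + f + e) * c * ((c + f + c) * (c + f + c)) ≤_) (sym (difference c f e)) (m≤m+n _ _)
  where
  difference : ∀ c f e → 4 * (c + f) * c * ((c + f + e + c) * (c + f + e + c))
                       ≡ 4 * (c + f + e) * c * ((c + f + c) * (c + f + c)) + 4 * c * e * (2 * c * f + f * f + (c + f) * e)
  difference = solve-∀

count : ∀ {n} → (Fin n → Bool) → ℕ
count {zero}  p = 0
count {suc n} p = (if p Fin.zero then 1 else 0) + count (p ∘ Fin.suc)

sum-allFin-count : ∀ {n} (p : Fin n → Bool) → sum (map (λ y → if p y then 1 else 0) (allFin n)) ≡ count p
sum-allFin-count p = trans (cong sum (map-tabulate id (λ y → if p y then 1 else 0))) (go p)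
  where
  go : ∀ {n} (p : Fin n → Bool) → sum (tabulate (λ y → if p y then 1 else 0)) ≡ count p
  go {zero}  p = refl
  go {suc n} p = cong (λ c → (if p Fin.zero then 1 else 0) + c) (go (p ∘ Fin.suc))

deg-count : ∀ {n} (G : Graph n) x → deg G x ≡ count (adj G x)
deg-count G x = sum-allFin-count (adj G x)

indicator-mono : ∀ {a b} → (a ≡ true → b ≡ true) → (if a then 1 else 0) ≤ (if b then 1 else 0)
indicator-mono {false} _   = z≤n
indicator-mono {true}  a⇒b rewrite a⇒b refl = ≤-refl

count-mono : ∀ {n} (p q : Fin n → Bool) → (∀ y → p y ≡ true → q y ≡ true) → count p ≤ count q
count-mono {zero}  p q p⇒q = z≤n
count-mono {suc n} p q p⇒q = +-mono-≤ (indicator-mono (p⇒q Fin.zero)) (count-mono (p ∘ Fin.suc) (q ∘ Fin.suc) (p⇒q ∘ Fin.suc))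

count-cong : ∀ {n} (p q : Fin n → Bool) → (∀ y → p y ≡ q y) → count p ≡ count q
count-cong p q p≗q = ≤-antisym (count-mono p q (λ y → trans (sym (p≗q y)))) (count-mono q p (λ y → trans (p≗q y)))

count-≥1 : ∀ {n} (p : Fin n → Bool) z → p z ≡ true → 1 ≤ count p
count-≥1 p Fin.zero    pz rewrite pz = s≤s z≤n
count-≥1 p (Fin.suc z) pz = ≤-trans (count-≥1 (p ∘ Fin.suc) z pz) (m≤n+m _ _)

count-false : ∀ n → count {n} (λ _ → false) ≡ 0
count-false zero    = refl
count-false (suc n) = count-false n

count-≟ : ∀ {n} (z : Fin n) → count (λ y → does (y ≟ z)) ≡ 1
count-≟ {suc n} Fin.zero    = cong suc (count-false n)
count-≟ {suc n} (Fin.suc z) = count-≟ z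

count-singleton : ∀ {n} (p : Fin n → Bool) z → (∀ y → p y ≡ true ⇔ y ≡ z) → count p ≡ 1
count-singleton p z p⇔≡z = trans (count-cong p (λ y → does (y ≟ z)) p≗≟) (count-≟ z)
  where
  p≗≟ : ∀ y → p y ≡ does (y ≟ z)
  p≗≟ y with p y in py | y ≟ z
  ... | true  | yes _   = refl
  ... | true  | no y≢z  = contradiction (Equivalence.to (p⇔≡z y) py) y≢z
  ... | false | yes y≡z = contradiction (trans (sym py) (Equivalence.from (p⇔≡z y) y≡z)) λ ()
  ... | false | no _    = refl

except : ∀ {n} → (Fin n → Bool) → Fin n → Fin n → Bool
except p z y = p y ∧ not (does (y ≟ z))

count-except : ∀ {n} (p : Fin n → Bool) z → p z ≡ true → suc (count (except p z)) ≡ count p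
count-except p Fin.zero pz rewrite pz = cong suc (count-cong _ _ (λ y → ∧-identityʳ (p (Fin.suc y))))
count-except p (Fin.suc z) pz with p Fin.zero
... | true  = cong suc (count-except (p ∘ Fin.suc) z pz)
... | false = count-except (p ∘ Fin.suc) z pz

orient : ∀ {n} → Fin n → Fin n → Fin n × Fin n
orient a b = if toℕ a <ᵇ toℕ b then (a , b) else (b , a)

orient-≡ : ∀ {n} {a b x y : Fin n} → orient a b ≡ (x , y) → (a ≡ x × b ≡ y) ⊎ (a ≡ y × b ≡ x)
orient-≡ {a = a} {b} eq with toℕ a <ᵇ toℕ b
orient-≡ refl | true  = inj₁ (refl , refl)
orient-≡ refl | false = inj₂ (refl , refl)

orient-< : ∀ {n} {a b : Fin n} → a ≢ b → toℕ (proj₁ (orient a b)) < toℕ (proj₂ (orient a b))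
orient-< {a = a} {b} a≢b with toℕ a <ᵇ toℕ b in a<ᵇb
... | true  = <ᵇ⇒< (toℕ a) (toℕ b) (Equivalence.from T-≡ a<ᵇb)
... | false = ≤∧≢⇒< (≮⇒≥ (λ a<b → subst T a<ᵇb (<⇒<ᵇ a<b))) (λ b≡a → a≢b (toℕ-injective (sym b≡a)))

orient-injective : ∀ {n} {a b c d : Fin n} → orient a b ≡ orient c d → (a ≡ c × b ≡ d) ⊎ (a ≡ d × b ≡ c)
orient-injective {c = c} {d} eq with toℕ c <ᵇ toℕ d
... | true  = orient-≡ eq
... | false = Data.Sum.swap (orient-≡ eq)

concatMap-cartesianProduct : ∀ {A B C : Set} (g : A × B → List C) xs ys →
  concatMap g (cartesianProduct xs ys) ≡ concatMap (λ x → concatMap (λ y → g (x , y)) ys) xs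
concatMap-cartesianProduct g []       ys = refl
concatMap-cartesianProduct g (x ∷ xs) ys = begin
  concatMap g (map (x ,_) ys ++ cartesianProduct xs ys)                     ≡⟨ concatMap-++ g (map (x ,_) ys) _ ⟩
  concatMap g (map (x ,_) ys) ++ concatMap g (cartesianProduct xs ys)
    ≡⟨ cong₂ _++_ (concatMap-map g (x ,_) ys) (concatMap-cartesianProduct g xs ys) ⟩
  concatMap (λ y → g (x , y)) ys ++ concatMap (λ x → concatMap (λ y → g (x , y)) ys) xs ∎
  where open ≡-Reasoning

concatMap-if-singleton : ∀ {A B : Set} (b : A → Bool) (f : A → B) xs →
  concatMap (λ a → if b a then [ f a ] else []) xs ≡ map f (filterᵇ b xs)
concatMap-if-singleton b f []       = refl
concatMap-if-singleton b f (a ∷ xs) with b a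
... | true  = cong (f a ∷_) (concatMap-if-singleton b f xs)
... | false = concatMap-if-singleton b f xs

module _ {n : ℕ} (G : Graph n) where

  isOrientedEdge : Fin n × Fin n → Bool
  isOrientedEdge (x , y) = adj G x y ∧ (toℕ x <ᵇ toℕ y)

  edges : List (Fin n × Fin n)
  edges = filterᵇ isOrientedEdge (cartesianProduct (allFin n) (allFin n))

  edgeTerm : Fin n × Fin n → ℕ × ℕ
  edgeTerm (x , y) = gaTerm (deg G x) (deg G y)

  GAterms-edges : GAterms G ≡ map edgeTerm edges
  GAterms-edges = begin
    GAterms G
      ≡⟨ concatMap-cartesianProduct (λ e → if isOrientedEdge e then [ edgeTerm e ] else []) (allFin n) (allFin n) ⟨
    concatMap (λ e → if isOrientedEdge e then [ edgeTerm e ] else []) (cartesianProduct (allFin n) (allFin n))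
      ≡⟨ concatMap-if-singleton isOrientedEdge edgeTerm (cartesianProduct (allFin n) (allFin n)) ⟩
    map edgeTerm edges ∎
    where open ≡-Reasoning

  ∈-edges⁻ : ∀ {x y} → (x , y) ∈ edges → Adj G x y × toℕ x < toℕ y
  ∈-edges⁻ e∈ with Equivalence.to T-∧ (proj₂ (∈-filter⁻ (T? ∘ isOrientedEdge) {xs = cartesianProduct (allFin n) (allFin n)} e∈))
  ... | adj-xy , x<ᵇy = Equivalence.to T-≡ adj-xy , <ᵇ⇒< _ _ x<ᵇy

  ∈-edges⁺ : ∀ {x y} → Adj G x y → toℕ x < toℕ y → (x , y) ∈ edges
  ∈-edges⁺ {x} {y} x~y x<y = ∈-filter⁺ (T? ∘ isOrientedEdge) (∈-cartesianProduct⁺ (∈-allFin x) (∈-allFin y))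
    (Equivalence.from T-∧ (Equivalence.from T-≡ x~y , <⇒<ᵇ x<y))

  edges-unique : Unique edges
  edges-unique = Unique.filter⁺ (T? ∘ isOrientedEdge) (Unique.cartesianProduct⁺ (Unique.allFin⁺ n) (Unique.allFin⁺ n))

  edgeTerm-orient : ∀ a b → edgeTerm (orient a b) ≡ gaTerm (deg G a) (deg G b)
  edgeTerm-orient a b with toℕ a <ᵇ toℕ b
  ... | true  = refl
  ... | false = gaTerm-comm (deg G b) (deg G a)

  Adj⇒≢ : ∀ {a b} → Adj G a b → a ≢ b
  Adj⇒≢ {a} a~a refl = contradiction (trans (sym a~a) (adj-irr G a)) λ ()

  Adj-sym : ∀ {a b} → Adj G a b → Adj G b a
  Adj-sym {a} {b} a~b = trans (adj-sym G b a) a~b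

  deg-positive : ∀ {a b} → Adj G a b → 1 ≤ deg G a
  deg-positive {a} {b} a~b = subst (1 ≤_) (sym (deg-count G a)) (count-≥1 (adj G a) b a~b)

  orient-∈-edges : ∀ {a b} → Adj G a b → orient a b ∈ edges
  orient-∈-edges {a} {b} a~b with toℕ a <ᵇ toℕ b | orient-< (Adj⇒≢ a~b)
  ... | true  | a<b = ∈-edges⁺ a~b a<b
  ... | false | b<a = ∈-edges⁺ (Adj-sym a~b) b<a

-- Walks, paths and the cycle

module Walks {n : ℕ} (G : Graph n) where

  walkLength : ∀ {P s e} → WalkWithin G P s e → ℕ
  walkLength stop         = 0
  walkLength (step _ _ W) = suc (walkLength W)

  _▻_ : ∀ {P s m e} → WalkWithin G P s m → WalkWithin G P m e → WalkWithin G P s e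
  stop         ▻ V = V
  step a p W   ▻ V = step a p (W ▻ V)

  Walk-map : ∀ {P Q : Fin n → Set} {s e} → (∀ {u} → P u → Q u) → WalkWithin G P s e → WalkWithin G Q s e
  Walk-map f stop         = stop
  Walk-map f (step a p W) = step a (f p) (Walk-map f W)

  Chain : Fin n → List (Fin n) → Set
  Chain s []       = ⊤
  Chain s (y ∷ ys) = Adj G s y × Chain y ys

  endpoint : Fin n → List (Fin n) → Fin n
  endpoint s []       = s
  endpoint s (y ∷ ys) = endpoint y ys

  endpoint-∈ : ∀ s y ys → endpoint s (y ∷ ys) ∈ y ∷ ys
  endpoint-∈ s y []        = here refl
  endpoint-∈ s y (z ∷ ys) = there (endpoint-∈ y z ys)

  endpoint-++ : ∀ s xs ys → endpoint s (xs ++ ys) ≡ endpoint (endpoint s xs) ys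
  endpoint-++ s []       ys = refl
  endpoint-++ s (y ∷ xs) ys = endpoint-++ y xs ys

  Chain-++ : ∀ s xs ys → Chain s xs → Chain (endpoint s xs) ys → Chain s (xs ++ ys)
  Chain-++ s []       ys _         c = c
  Chain-++ s (y ∷ xs) ys (a , cxs) c = a , Chain-++ y xs ys cxs c

  Chain-suffix : ∀ s xs z ys → Chain s (xs ++ z ∷ ys) → Chain z ys × endpoint s (xs ++ z ∷ ys) ≡ endpoint z ys
  Chain-suffix s []       z ys (_ , c) = c , refl
  Chain-suffix s (y ∷ xs) z ys (_ , c) = Chain-suffix y xs z ys c

  IsWalkList⇒Chain : ∀ s xs → IsWalkList G (s ∷ xs) → Chain s xs
  IsWalkList⇒Chain s []       _       = tt
  IsWalkList⇒Chain s (y ∷ xs) (a , w) = a , IsWalkList⇒Chain y xs w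

  Chain⇒IsWalkList : ∀ s xs → Chain s xs → IsWalkList G (s ∷ xs)
  Chain⇒IsWalkList s []       _       = tt
  Chain⇒IsWalkList s (y ∷ xs) (a , c) = a , Chain⇒IsWalkList y xs c

  record Path (P : Fin n → Set) (s e : Fin n) : Set where
    field
      vertices : List (Fin n)
      chain    : Chain s vertices
      ends     : endpoint s vertices ≡ e
      inside   : All P vertices
      distinct : Unique (s ∷ vertices)

  Path-suffix : ∀ {P y e} (p : Path P y e) α {s} β → y ∷ Path.vertices p ≡ α ++ s ∷ β → Path P s e
  Path-suffix p [] β refl = p
  Path-suffix {y = y} record { chain = c ; ends = ends ; inside = ps ; distinct = _ ∷ vs! } (_ ∷ α) {s} β refl =
    record
      { vertices = β
      ; chain    = proj₁ (Chain-suffix y α s β c)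
      ; ends     = trans (sym (proj₂ (Chain-suffix y α s β c))) ends
      ; inside   = All.tail (All.++⁻ʳ α ps)
      ; distinct = Unique-++⁻ʳ α vs!
      }

  open import Data.List.Membership.DecPropositional (_≟_ {n}) using (_∈?_)

  walk⇒path : ∀ {P s e} → WalkWithin G P s e → Path P s e
  walk⇒path stop = record { vertices = [] ; chain = tt ; ends = refl ; inside = [] ; distinct = [] ∷ [] }
  walk⇒path {s = s} (step {y = y} a py W) with p ← walk⇒path W | s ∈? y ∷ Path.vertices p
  ... | yes s∈ with α , β , eq ← ∈-∃++ s∈ = Path-suffix p α β eq
  ... | no s∉ = record
    { vertices = y ∷ Path.vertices p
    ; chain    = a , Path.chain p
    ; ends     = Path.ends p
    ; inside   = py ∷ Path.inside p
    ; distinct = All.tabulate (λ { z∈ refl → s∉ z∈ }) ∷ Path.distinct p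
    }

  Chain⇒Walk-∈ : ∀ s xs → Chain s xs → WalkWithin G (_∈ xs) s (endpoint s xs)
  Chain⇒Walk-∈ s []       _       = stop
  Chain⇒Walk-∈ s (y ∷ xs) (a , c) = step a (here refl) (Walk-map there (Chain⇒Walk-∈ y xs c))

  Chain-walk-from : ∀ s xs {x} → Chain s xs → x ∈ xs → WalkWithin G (_∈ xs) x (endpoint s xs)
  Chain-walk-from s (y ∷ xs) (a , c) (here refl) = Walk-map there (Chain⇒Walk-∈ y xs c)
  Chain-walk-from s (y ∷ xs) (a , c) (there x∈) = Walk-map there (Chain-walk-from y xs c x∈)

  Chain-walk-to : ∀ s xs {x} → Chain s xs → x ∈ xs → WalkWithin G (_∈ xs) s x
  Chain-walk-to s (y ∷ xs) (a , c) (here refl) = step a (here refl) stop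
  Chain-walk-to s (y ∷ xs) (a , c) (there x∈) = step a (here refl) (Walk-map there (Chain-walk-to y xs c x∈))

  cycle-walk : ∀ {c x y} → IsCycle G c → x ∈ c → y ∈ c → WalkWithin G (_∈ c) x y
  cycle-walk {h ∷ r} {x} {y} (_ , _ , closed) x∈c y∈c =
    Walk-map L⊆c (subst (WalkWithin G (_∈ L) x) (endpoint-++ h r [ h ]) (Chain-walk-from h L chain (c⊆L x∈c))
                  ▻ Chain-walk-to h L chain (c⊆L y∈c))
    where
    L = r ++ [ h ]
    chain : Chain h L
    chain = IsWalkList⇒Chain h L closed
    L⊆c : ∀ {z} → z ∈ L → z ∈ h ∷ r
    L⊆c z∈L with ∈-++⁻ r z∈L
    ... | inj₁ z∈r        = there z∈r
    ... | inj₂ (here refl) = here refl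
    c⊆L : ∀ {z} → z ∈ h ∷ r → z ∈ L
    c⊆L (here refl) = ∈-++⁺ʳ r (here refl)
    c⊆L (there z∈r) = ∈-++⁺ˡ z∈r

  consecutive-∈ : ∀ xs {a b} → (a , b) ∈ consecutive G xs → a ∈ xs × b ∈ xs
  consecutive-∈ (x ∷ y ∷ xs) (here refl) = here refl , there (here refl)
  consecutive-∈ (x ∷ y ∷ xs) (there ab∈) = Data.Product.map there there (consecutive-∈ (y ∷ xs) ab∈)

  close-∈ : ∀ xs {a} → a ∈ close G xs → a ∈ xs
  close-∈ (x ∷ xs) (here refl) = here refl
  close-∈ (x ∷ xs) (there a∈) with ∈-++⁻ xs a∈
  ... | inj₁ a∈xs        = there a∈xs
  ... | inj₂ (here refl) = here refl

  ∈⇒consecutive : ∀ xs e {u} → u ∈ xs → ∃ λ u⁺ → (u , u⁺) ∈ consecutive G (xs ++ [ e ])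
  ∈⇒consecutive (y ∷ [])     e (here refl) = e , here refl
  ∈⇒consecutive (y ∷ z ∷ xs) e (here refl) = z , here refl
  ∈⇒consecutive (y ∷ z ∷ xs) e (there u∈) = Data.Product.map₂ there (∈⇒consecutive (z ∷ xs) e u∈)

  -- A cycle vertex lies on the unique cycle, because one of its cycle edges does.
  unicyclic-cycleVertex : (U : Unicyclic G) → ∀ {u} → CycleVertex G u → u ∈ proj₁ (proj₂ U)
  unicyclic-cycleVertex (_ , c , _ , same-edges) (d@(h ∷ r) , d-cycle , u∈d)
    with u⁺ , uu⁺∈d ← ∈⇒consecutive d h u∈d
    with Equivalence.from (same-edges d d-cycle _ u⁺) (inj₁ uu⁺∈d)
  ... | inj₁ uu⁺∈c = close-∈ c (proj₁ (consecutive-∈ (close G c) uu⁺∈c))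
  ... | inj₂ u⁺u∈c = close-∈ c (proj₂ (consecutive-∈ (close G c) u⁺u∈c))

  -- The cycle consists of the first path, the edge wx and the second path.
  closing-cycle : ∀ {P Q : Fin n → Set} {v w x} → (∀ {u} → P u → ¬ Q u) →
    Path P v w → Path Q x v → Q x → w ≢ v → x ≢ v → Adj G w x → CycleVertex G w
  closing-cycle _ record { vertices = [] ; ends = v≡w } _ _ w≢v _ _ = contradiction (sym v≡w) w≢v
  closing-cycle _ record { vertices = _ ∷ _ } record { vertices = [] ; ends = x≡v } _ _ x≢v _ = contradiction x≡v x≢v
  closing-cycle {P} {Q} {v} {w} {x} P⇒¬Q
    record { vertices = t₁ ∷ t ; chain = v~t₁ , chain-t ; ends = t-ends ; inside = Pt ; distinct = _ ∷ t! }
    record { vertices = r₁ ∷ r ; chain = chain-r ; ends = r-ends ; inside = Qr ; distinct = xr! } Qx _ _ w~x =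
    D , (D-length , D! , D-closed) , ∈-++⁺ˡ (subst (_∈ t₁ ∷ t) t-ends (endpoint-∈ v t₁ t))
    where
    D = (t₁ ∷ t) ++ x ∷ r₁ ∷ r
    D-length : 3 ≤ length D
    D-length = s≤s (≤-trans (s≤s (s≤s z≤n)) (length-++-≤ʳ (x ∷ r₁ ∷ r) {t}))
    Q-xr : All Q (x ∷ r₁ ∷ r)
    Q-xr = Qx ∷ Qr
    D! : Unique D
    D! = Unique.++⁺ t! xr! (λ (z∈t , z∈xr) → P⇒¬Q (All.lookup Pt z∈t) (All.lookup Q-xr z∈xr))
    back : Chain x ((r₁ ∷ r) ++ [ t₁ ])
    back = Chain-++ x (r₁ ∷ r) [ t₁ ] chain-r (subst (λ e → Chain e [ t₁ ]) (sym r-ends) (v~t₁ , tt))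
    D-closed : IsWalkList G (close G D)
    D-closed = Chain⇒IsWalkList t₁ _ (subst (Chain t₁) (sym (++-assoc t (x ∷ r₁ ∷ r) [ t₁ ]))
      (Chain-++ t₁ t (x ∷ (r₁ ∷ r) ++ [ t₁ ]) chain-t
        (subst (λ e → Chain e (x ∷ (r₁ ∷ r) ++ [ t₁ ])) (sym t-ends) (w~x , back))))

  Walk-end : ∀ {P s e} → WalkWithin G P s e → s ≡ e ⊎ P e
  Walk-end stop = inj₁ refl
  Walk-end (step _ py W) with Walk-end W
  ... | inj₁ refl = inj₂ py
  ... | inj₂ pe   = inj₂ pe

  -- Otherwise a path in Tᵥ from v to w, the edge wx and the cycle arc from x to v form a cycle through w.
  pendantTree-no-cycle-neighbour : Unicyclic G → ∀ {v w x} → CycleVertex G v → CycleVertex G x → x ≢ v →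
    InPendantTree G v w → w ≢ v → ¬ Adj G w x
  pendantTree-no-cycle-neighbour U@(_ , c , c-cycle , _) v-cyc x-cyc x≢v W w≢v w~x
    with Walk-end W
  ... | inj₁ v≡w     = w≢v (sym v≡w)
  ... | inj₂ w-noncyc = w-noncyc (closing-cycle (λ ¬cyc cyc → ¬cyc cyc) (walk⇒path W) (walk⇒path V) x-cyc w≢v x≢v w~x)
    where
    V : WalkWithin G (CycleVertex G) _ _
    V = Walk-map (λ u∈c → c , c-cycle , u∈c)
                 (cycle-walk c-cycle (unicyclic-cycleVertex U x-cyc) (unicyclic-cycleVertex U v-cyc))

  Walk-last : ∀ {P s y e} (s~y : Adj G s y) (py : P y) (W : WalkWithin G P y e) →
    Σ (Fin n) λ p → Σ (WalkWithin G P s p) λ W′ → suc (walkLength W′) ≡ walkLength (step s~y py W) × Adj G p e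
  Walk-last {s = s} s~y _ stop = s , stop , refl , s~y
  Walk-last s~y py (step y~z pz W) with p , W′ , len , p~e ← Walk-last y~z pz W =
    p , step s~y py W′ , cong suc len , p~e

¬¬-finite-choice : ∀ {n} {P : Fin n → Set} → (∀ x → ¬ ¬ P x) → ¬ ¬ (∀ x → P x)
¬¬-finite-choice {zero}  _   = pure λ ()
¬¬-finite-choice {suc n} ¬¬P =
  ¬¬P Fin.zero >>= λ p₀ → ¬¬-finite-choice (¬¬P ∘ Fin.suc) >>= λ ps → pure (∀-cons p₀ ps)

Least : (ℕ → Set) → Set
Least P = Σ ℕ λ d → P d × ∀ {j} → P j → d ≤ j

¬¬-least : ∀ (P : ℕ → Set) {m} → P m → ¬ ¬ Least P
¬¬-least P {m} = <-rec (λ m → P m → ¬ ¬ Least P) search m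
  where
  search : ∀ m → (∀ {j} → j < m → P j → ¬ ¬ Least P) → P m → ¬ ¬ Least P
  search m smaller Pm = ¬¬-excluded-middle {A = ∃ λ j → j < m × P j} >>= λ where
    (yes (j , j<m , Pj)) → smaller j<m Pj
    (no none-smaller)    → pure (m , Pm , λ {j} Pj → ≮⇒≥ (λ j<m → none-smaller (j , j<m , Pj)))

-- The star transformation

module StarTransform {n : ℕ} (G G′ : Graph n) (v : Fin n) (U : Unicyclic G) (v-cyc : CycleVertex G v)
  (v-max : ∀ u → CycleVertex G u → deg G u ≤ deg G v) (star : IsStarTransform G v G′) where

  open Walks G

  Tᵥ : Fin n → Set
  Tᵥ = InPendantTree G v

  v∈Tᵥ : Tᵥ v
  v∈Tᵥ = stop

  adj′-outside : ∀ {x y} → ¬ (Tᵥ x × Tᵥ y) → adj G′ x y ≡ adj G x y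
  adj′-outside {x} {y} = proj₂ (star x y)

  adj′-inside : ∀ {x y} → Tᵥ x → Tᵥ y → Adj G′ x y ⇔ (x ≢ y × (x ≡ v ⊎ y ≡ v))
  adj′-inside {x} {y} Tx Ty = proj₁ (star x y) (Tx , Ty)

  record VertexDecision (x : Fin n) : Set where
    field
      inTree?  : Dec (Tᵥ x)
      cycle?   : Dec (CycleVertex G x)
      depth    : ℕ
      depth-≤  : (W : Tᵥ x) → depth ≤ walkLength W
      shortest : Tᵥ x → Σ (Tᵥ x) λ W → walkLength W ≡ depth

  module WithDecisions (decisions : ∀ x → VertexDecision x) where
    open module Decide (x : Fin n) = VertexDecision (decisions x)

    inTree : Fin n → Bool
    inTree x = does (inTree? x)

    inTree-complete : ∀ {x} → Tᵥ x → inTree x ≡ true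
    inTree-complete {x} Tx with inTree? x
    ... | yes _  = refl
    ... | no ¬Tx = contradiction Tx ¬Tx

    Tᵥ-closed : ∀ {w y} → Tᵥ w → w ≢ v → Adj G w y → Tᵥ y
    Tᵥ-closed {w} {y} Tw w≢v w~y with cycle? y | y ≟ v
    ... | no ¬cyc | _        = Tw ▻ step w~y ¬cyc stop
    ... | yes _   | yes refl = stop
    ... | yes cyc | no y≢v   = contradiction w~y (pendantTree-no-cycle-neighbour U v-cyc cyc y≢v Tw w≢v)

    outside-neighbour-on-cycle : ∀ {y} → Adj G v y → ¬ Tᵥ y → CycleVertex G y
    outside-neighbour-on-cycle {y} v~y ¬Ty with cycle? y
    ... | yes cyc  = cyc
    ... | no ¬cyc  = contradiction (step v~y ¬cyc stop) ¬Ty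

    except-inTree⁻ : ∀ {z y} → except inTree z y ≡ true → Tᵥ y × y ≢ z
    except-inTree⁻ {z} {y} eq with inTree? y | y ≟ z
    ... | yes Ty | no y≢z = Ty , y≢z
    ... | yes _  | yes _  = contradiction eq λ ()
    ... | no _   | _      = contradiction eq λ ()

    except-inTree⁺ : ∀ {z y} → Tᵥ y → y ≢ z → except inTree z y ≡ true
    except-inTree⁺ {z} {y} Ty y≢z with inTree? y | y ≟ z
    ... | yes _  | no _    = refl
    ... | yes _  | yes y≡z = contradiction y≡z y≢z
    ... | no ¬Ty | _       = contradiction Ty ¬Ty

    D : ℕ
    D = deg G′ v

    deg′-outside : ∀ {x} → ¬ Tᵥ x → deg G′ x ≡ deg G x
    deg′-outside {x} ¬Tx = begin
      deg G′ x          ≡⟨ deg-count G′ x ⟩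
      count (adj G′ x)  ≡⟨ count-cong (adj G′ x) (adj G x) (λ y → adj′-outside (¬Tx ∘ proj₁)) ⟩
      count (adj G x)   ≡⟨ deg-count G x ⟨
      deg G x           ∎
      where open ≡-Reasoning

    deg′-leaf : ∀ {w} → Tᵥ w → w ≢ v → deg G′ w ≡ 1
    deg′-leaf {w} Tw w≢v = trans (deg-count G′ w) (count-singleton (adj G′ w) v w~y⇔y≡v)
      where
      w~y⇔y≡v : ∀ y → Adj G′ w y ⇔ y ≡ v
      w~y⇔y≡v y with inTree? y
      ... | yes Ty = mk⇔ (λ w~y → [ (λ w≡v → contradiction w≡v w≢v) , id ]′ (proj₂ (Equivalence.to (adj′-inside Tw Ty) w~y)))
                         (λ { refl → Equivalence.from (adj′-inside Tw Ty) (w≢v , inj₂ refl) })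
      ... | no ¬Ty = mk⇔ (λ w~y → contradiction (Tᵥ-closed Tw w≢v (trans (sym (adj′-outside (¬Ty ∘ proj₂))) w~y)) ¬Ty)
                         (λ { refl → contradiction stop ¬Ty })

    deg-v≤D : deg G v ≤ D
    deg-v≤D = subst₂ _≤_ (sym (deg-count G v)) (sym (deg-count G′ v)) (count-mono (adj G v) (adj G′ v) v~y⇒v~′y)
      where
      v~y⇒v~′y : ∀ y → Adj G v y → Adj G′ v y
      v~y⇒v~′y y v~y with inTree? y
      ... | yes Ty = Equivalence.from (adj′-inside stop Ty) (Adj⇒≢ G v~y , inj₁ refl)
      ... | no ¬Ty = trans (adj′-outside (¬Ty ∘ proj₂)) v~y

    |Tᵥ-v|≤D : count (except inTree v) ≤ D
    |Tᵥ-v|≤D = subst (count (except inTree v) ≤_) (sym (deg-count G′ v)) (count-mono (except inTree v) (adj G′ v) v~′y)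
      where
      v~′y : ∀ y → except inTree v y ≡ true → Adj G′ v y
      v~′y y y∈Tᵥ-v with Ty , y≢v ← except-inTree⁻ y∈Tᵥ-v =
        Equivalence.from (adj′-inside stop Ty) ((λ v≡y → y≢v (sym v≡y)) , inj₁ refl)

    deg-≤|Tᵥ-w| : ∀ {w} → Tᵥ w → w ≢ v → deg G w ≤ count (except inTree w)
    deg-≤|Tᵥ-w| {w} Tw w≢v =
      subst (_≤ count (except inTree w)) (sym (deg-count G w)) (count-mono (adj G w) (except inTree w) w~y⇒y∈Tᵥ-w)
      where
      w~y⇒y∈Tᵥ-w : ∀ y → Adj G w y → except inTree w y ≡ true
      w~y⇒y∈Tᵥ-w y w~y = except-inTree⁺ (Tᵥ-closed Tw w≢v w~y) (λ y≡w → Adj⇒≢ G w~y (sym y≡w))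

    |Tᵥ-w|≡|Tᵥ-v| : ∀ {w} → Tᵥ w → count (except inTree w) ≡ count (except inTree v)
    |Tᵥ-w|≡|Tᵥ-v| Tw = suc-injective
      (trans (count-except inTree _ (inTree-complete Tw)) (sym (count-except inTree v (inTree-complete v∈Tᵥ))))

    -- The G-neighbours of w lie in Tᵥ, and v is joined in G′ to every other vertex of Tᵥ.
    deg-Tᵥ≤D : ∀ {u} → Tᵥ u → deg G u ≤ D
    deg-Tᵥ≤D {u} Tu with u ≟ v
    ... | yes refl = deg-v≤D
    ... | no u≢v   = begin
      deg G u                    ≤⟨ deg-≤|Tᵥ-w| Tu u≢v ⟩
      count (except inTree u)    ≡⟨ |Tᵥ-w|≡|Tᵥ-v| Tu ⟩
      count (except inTree v)    ≤⟨ |Tᵥ-v|≤D ⟩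
      D                          ∎
      where open ≤-Reasoning

    parent-exists : ∀ {w} → Tᵥ w → w ≢ v → Σ (Fin n) λ p → Adj G p w × Tᵥ p × depth p < depth w
    parent-exists {w} Tw w≢v with shortest w Tw
    ... | stop , _ = contradiction refl w≢v
    ... | step v~y py W , len≡depth with p , W′ , len , p~w ← Walk-last v~y py W =
      p , p~w , W′ , (begin-strict
        depth p                     ≤⟨ depth-≤ p W′ ⟩
        walkLength W′               <⟨ n<1+n (walkLength W′) ⟩
        suc (walkLength W′)         ≡⟨ len ⟩
        walkLength (step v~y py W)  ≡⟨ len≡depth ⟩
        depth w                     ∎)
      where open ≤-Reasoning

    parent : Fin n → Fin n
    parent w with inTree? w | w ≟ v
    ... | yes Tw | no w≢v = proj₁ (parent-exists Tw w≢v)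
    ... | _      | _      = v

    parent-spec : ∀ {w} → Tᵥ w → w ≢ v → Adj G (parent w) w × Tᵥ (parent w) × depth (parent w) < depth w
    parent-spec {w} Tw w≢v with inTree? w | w ≟ v
    ... | yes Tw′ | no w≢v′ = proj₂ (parent-exists Tw′ w≢v′)
    ... | yes _   | yes w≡v = contradiction w≡v w≢v
    ... | no ¬Tw  | _       = contradiction Tw ¬Tw

    treeEdge : Fin n → Fin n × Fin n
    treeEdge w = orient w (parent w)

    treeEdge-∈ : ∀ {w} → Tᵥ w → w ≢ v → treeEdge w ∈ edges G
    treeEdge-∈ Tw w≢v = orient-∈-edges G (Adj-sym G (proj₁ (parent-spec Tw w≢v)))

    treeEdge-inside : ∀ {w x y} → Tᵥ w → w ≢ v → treeEdge w ≡ (x , y) → Tᵥ x × Tᵥ y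
    treeEdge-inside Tw w≢v eq with orient-≡ eq | proj₁ (proj₂ (parent-spec Tw w≢v))
    ... | inj₁ (refl , refl) | Tp = Tw , Tp
    ... | inj₂ (refl , refl) | Tp = Tp , Tw

    treeEdge-injective : ∀ {w₁ w₂} → Tᵥ w₁ → w₁ ≢ v → Tᵥ w₂ → w₂ ≢ v → treeEdge w₁ ≡ treeEdge w₂ → w₁ ≡ w₂
    treeEdge-injective {w₂ = w₂} T₁ n₁ T₂ n₂ eq with orient-injective eq
    ... | inj₁ (w₁≡w₂ , _)     = w₁≡w₂
    ... | inj₂ (refl , p₁≡w₂) =
      contradiction (proj₂ (proj₂ (parent-spec T₂ n₂)))
        (<-asym (subst (λ u → depth u < depth (parent w₂)) p₁≡w₂ (proj₂ (proj₂ (parent-spec T₁ n₁)))))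

    data G′-Edge : Fin n → Fin n → Set where
      centre-leaf : ∀ {w} → Tᵥ w → w ≢ v → G′-Edge v w
      leaf-centre : ∀ {w} → Tᵥ w → w ≢ v → G′-Edge w v
      kept        : ∀ {x y} → ¬ (Tᵥ x × Tᵥ y) → Adj G x y → G′-Edge x y

    classify : ∀ {x y} → Adj G′ x y → G′-Edge x y
    classify {x} {y} x~′y with inTree? x | inTree? y
    ... | yes Tx | yes Ty with Equivalence.to (adj′-inside Tx Ty) x~′y
    ...   | x≢y , inj₁ refl = centre-leaf Ty (λ y≡v → x≢y (sym y≡v))
    ...   | x≢y , inj₂ refl = leaf-centre Tx x≢y
    classify x~′y | no ¬Tx | _      = kept (¬Tx ∘ proj₁) (trans (sym (adj′-outside (¬Tx ∘ proj₁))) x~′y)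
    classify x~′y | yes _  | no ¬Ty = kept (¬Ty ∘ proj₂) (trans (sym (adj′-outside (¬Ty ∘ proj₂))) x~′y)

    starLeaf : Fin n → Fin n → Fin n
    starLeaf x y = if does (x ≟ v) then y else x

    starLeaf-centre : ∀ w → starLeaf v w ≡ w
    starLeaf-centre w with v ≟ v
    ... | yes _  = refl
    ... | no v≢v = contradiction refl v≢v

    starLeaf-leaf : ∀ {w} → w ≢ v → starLeaf w v ≡ w
    starLeaf-leaf {w} w≢v with w ≟ v
    ... | yes w≡v = contradiction w≡v w≢v
    ... | no _    = refl

    -- A star edge vw of G′ is matched with the edge joining w to its parent in Tᵥ; all other edges of G′ are edges of G.
    matchEdge : Fin n × Fin n → Fin n × Fin n
    matchEdge (x , y) = if inTree x ∧ inTree y then treeEdge (starLeaf x y) else (x , y)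

    matchEdge-centre-leaf : ∀ {w} → Tᵥ w → matchEdge (v , w) ≡ treeEdge w
    matchEdge-centre-leaf {w} Tw rewrite inTree-complete v∈Tᵥ | inTree-complete Tw = cong treeEdge (starLeaf-centre w)

    matchEdge-leaf-centre : ∀ {w} → Tᵥ w → w ≢ v → matchEdge (w , v) ≡ treeEdge w
    matchEdge-leaf-centre Tw w≢v rewrite inTree-complete v∈Tᵥ | inTree-complete Tw = cong treeEdge (starLeaf-leaf w≢v)

    matchEdge-kept : ∀ {x y} → ¬ (Tᵥ x × Tᵥ y) → matchEdge (x , y) ≡ (x , y)
    matchEdge-kept {x} {y} ¬Txy with inTree? x | inTree? y
    ... | yes Tx | yes Ty = contradiction (Tx , Ty) ¬Txy
    ... | yes _  | no _   = refl
    ... | no _   | _      = refl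

    matchEdge-∈ : ∀ {e} → e ∈ edges G′ → matchEdge e ∈ edges G
    matchEdge-∈ {x , y} e∈ with classify (proj₁ (∈-edges⁻ G′ e∈))
    ... | centre-leaf Tw w≢v = subst (_∈ edges G) (sym (matchEdge-centre-leaf Tw)) (treeEdge-∈ Tw w≢v)
    ... | leaf-centre Tw w≢v = subst (_∈ edges G) (sym (matchEdge-leaf-centre Tw w≢v)) (treeEdge-∈ Tw w≢v)
    ... | kept ¬Txy x~y      = subst (_∈ edges G) (sym (matchEdge-kept ¬Txy)) (∈-edges⁺ G x~y (proj₂ (∈-edges⁻ G′ e∈)))

    star-edge-≤ₛ : ∀ {w} → Tᵥ w → w ≢ v → gaTerm D 1 ≤ₛ edgeTerm G (treeEdge w)
    star-edge-≤ₛ {w} Tw w≢v = subst (gaTerm D 1 ≤ₛ_) (sym (edgeTerm-orient G w (parent w)))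
      (gaTerm-pendant-≤ₛ D (deg G w) (deg G (parent w))
        (deg-positive G (Adj-sym G p~w)) (deg-positive G p~w) (deg-Tᵥ≤D Tw) (deg-Tᵥ≤D Tp))
      where
      p~w = proj₁ (parent-spec Tw w≢v)
      Tp  = proj₁ (proj₂ (parent-spec Tw w≢v))

    centre-edge-≤ₛ : ∀ {y} → ¬ Tᵥ y → Adj G v y → gaTerm D (deg G′ y) ≤ₛ gaTerm (deg G v) (deg G y)
    centre-edge-≤ₛ {y} ¬Ty v~y rewrite deg′-outside ¬Ty =
      gaTerm-antitone (deg G y) (deg G v) D (v-max y (outside-neighbour-on-cycle v~y ¬Ty)) deg-v≤D

    kept-edge-≤ₛ : ∀ {x y} → ¬ (Tᵥ x × Tᵥ y) → Adj G x y → edgeTerm G′ (x , y) ≤ₛ edgeTerm G (x , y)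
    kept-edge-≤ₛ {x} {y} ¬Txy x~y with inTree? x | inTree? y
    ... | yes Tx  | yes Ty  = contradiction (Tx , Ty) ¬Txy
    ... | no ¬Tx  | no ¬Ty rewrite deg′-outside ¬Tx | deg′-outside ¬Ty = ≤ₛ-refl (edgeTerm G (x , y))
    ... | yes Tx  | no ¬Ty with x ≟ v
    ...   | yes refl = centre-edge-≤ₛ ¬Ty x~y
    ...   | no x≢v   = contradiction (Tᵥ-closed Tx x≢v x~y) ¬Ty
    kept-edge-≤ₛ {x} {y} ¬Txy x~y | no ¬Tx | yes Ty with y ≟ v
    ...   | yes refl = subst₂ _≤ₛ_ (gaTerm-comm D (deg G′ x)) (gaTerm-comm (deg G v) (deg G x)) (centre-edge-≤ₛ ¬Tx (Adj-sym G x~y))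
    ...   | no y≢v   = contradiction (Tᵥ-closed Ty y≢v (Adj-sym G x~y)) ¬Tx

    matchEdge-≤ₛ : ∀ {e} → e ∈ edges G′ → edgeTerm G′ e ≤ₛ edgeTerm G (matchEdge e)
    matchEdge-≤ₛ {x , y} e∈ with classify (proj₁ (∈-edges⁻ G′ e∈))
    ... | centre-leaf Tw w≢v rewrite matchEdge-centre-leaf Tw | deg′-leaf Tw w≢v = star-edge-≤ₛ Tw w≢v
    ... | leaf-centre {w} Tw w≢v rewrite matchEdge-leaf-centre Tw w≢v | deg′-leaf Tw w≢v =
      subst (_≤ₛ edgeTerm G (treeEdge w)) (gaTerm-comm D 1) (star-edge-≤ₛ Tw w≢v)
    ... | kept ¬Txy x~y rewrite matchEdge-kept ¬Txy = kept-edge-≤ₛ ¬Txy x~y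

    matchEdge-injective : ∀ {e₁ e₂} → e₁ ∈ edges G′ → e₂ ∈ edges G′ → matchEdge e₁ ≡ matchEdge e₂ → e₁ ≡ e₂
    matchEdge-injective {x₁ , y₁} {x₂ , y₂} e₁∈ e₂∈ eq
      with classify (proj₁ (∈-edges⁻ G′ e₁∈)) | classify (proj₁ (∈-edges⁻ G′ e₂∈))
    ... | kept ¬T₁ _ | kept ¬T₂ _ = trans (sym (matchEdge-kept ¬T₁)) (trans eq (matchEdge-kept ¬T₂))
    ... | centre-leaf T₁ n₁ | kept ¬T₂ _ =
      contradiction (treeEdge-inside T₁ n₁ (trans (sym (matchEdge-centre-leaf T₁)) (trans eq (matchEdge-kept ¬T₂)))) ¬T₂
    ... | leaf-centre T₁ n₁ | kept ¬T₂ _ =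
      contradiction (treeEdge-inside T₁ n₁ (trans (sym (matchEdge-leaf-centre T₁ n₁)) (trans eq (matchEdge-kept ¬T₂)))) ¬T₂
    ... | kept ¬T₁ _ | centre-leaf T₂ n₂ =
      contradiction (treeEdge-inside T₂ n₂ (trans (sym (matchEdge-centre-leaf T₂)) (trans (sym eq) (matchEdge-kept ¬T₁)))) ¬T₁
    ... | kept ¬T₁ _ | leaf-centre T₂ n₂ =
      contradiction (treeEdge-inside T₂ n₂ (trans (sym (matchEdge-leaf-centre T₂ n₂)) (trans (sym eq) (matchEdge-kept ¬T₁)))) ¬T₁
    ... | centre-leaf T₁ n₁ | centre-leaf T₂ n₂ =
      cong (v ,_) (treeEdge-injective T₁ n₁ T₂ n₂ (trans (sym (matchEdge-centre-leaf T₁)) (trans eq (matchEdge-centre-leaf T₂))))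
    ... | leaf-centre T₁ n₁ | leaf-centre T₂ n₂ =
      cong (_, v) (treeEdge-injective T₁ n₁ T₂ n₂ (trans (sym (matchEdge-leaf-centre T₁ n₁)) (trans eq (matchEdge-leaf-centre T₂ n₂))))
    ... | centre-leaf T₁ n₁ | leaf-centre T₂ n₂
      with refl ← treeEdge-injective T₁ n₁ T₂ n₂ (trans (sym (matchEdge-centre-leaf T₁)) (trans eq (matchEdge-leaf-centre T₂ n₂))) =
      contradiction (proj₂ (∈-edges⁻ G′ e₁∈)) (<-asym (proj₂ (∈-edges⁻ G′ e₂∈)))
    ... | leaf-centre T₁ n₁ | centre-leaf T₂ n₂
      with refl ← treeEdge-injective T₁ n₁ T₂ n₂ (trans (sym (matchEdge-leaf-centre T₁ n₁)) (trans eq (matchEdge-centre-leaf T₂))) =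
      contradiction (proj₂ (∈-edges⁻ G′ e₁∈)) (<-asym (proj₂ (∈-edges⁻ G′ e₂∈)))

    GA-decreases : G′ GA≤ G
    GA-decreases = subst₂ _≤√_ (sym (GAterms-edges G′)) (sym (GAterms-edges G))
      (≤√-by-injection (edgeTerm G′) (edgeTerm G) (edges G′) (edges G) matchEdge
        (edges-unique G′) matchEdge-injective matchEdge-∈ matchEdge-≤ₛ edge-positive)
      where
      edge-positive : ∀ {e} → e ∈ edges G → 1 ≤ proj₂ (edgeTerm G e)
      edge-positive {x , y} e∈ = ≤-trans (deg-positive G (proj₁ (∈-edges⁻ G e∈))) (m≤m+n (deg G x) (deg G y))

  ¬¬-shortest : ∀ x → ¬ ¬ (Σ ℕ λ d → (∀ (W : Tᵥ x) → d ≤ walkLength W) × (Tᵥ x → Σ (Tᵥ x) λ W → walkLength W ≡ d))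
  ¬¬-shortest x = ¬¬-excluded-middle >>= λ where
    (no ¬Tx) → pure (0 , (λ _ → z≤n) , λ Tx → contradiction Tx ¬Tx)
    (yes W₀) → ¬¬-least (λ ℓ → Σ (Tᵥ x) λ W → walkLength W ≡ ℓ) (W₀ , refl) >>= λ where
      (d , (W , len≡d) , minimal) → pure (d , (λ W′ → minimal (W′ , refl)) , λ _ → W , len≡d)

  vertexDecision : ∀ x → ¬ ¬ VertexDecision x
  vertexDecision x =
    ¬¬-excluded-middle >>= λ inTree? →
    ¬¬-excluded-middle >>= λ cycle? →
    ¬¬-shortest x      >>= λ (d , depth-≤ , shortest) →
    pure (record { inTree? = inTree? ; cycle? = cycle? ; depth = d ; depth-≤ = depth-≤ ; shortest = shortest })

  GA-decreases : G′ GA≤ G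
  GA-decreases k =
    decidable-stable (low k (GAterms G′) ℚ.≤? low k (GAterms G) ℚ.+ errBound k (length (GAterms G)))
    (¬¬-finite-choice vertexDecision >>= λ decisions → pure (WithDecisions.GA-decreases decisions k))

mainTheorem4 : ∀ {n} (G G' : Graph n) (v : Fin n) →
    Unicyclic G → CycleVertex G v →
    (∀ u → CycleVertex G u → deg G u ≤ deg G v) →
    IsStarTransform G v G' →
    G' GA≤ G
mainTheorem4 G G' v U v-cyc v-max star = StarTransform.GA-decreases G G' v U v-cyc v-max star
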